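{- If $u,w$ are words over $\{1,2\}$, then $$\#R_2(wu)=\#R_2(w)+\#R_2(u)+\min(c_1(u),c_2(w)).$$
   Context: Juxtaposition denotes concatenation of words. $P(w)$ is the insertion tableau of $w$ under the Robinson–Schensted–Knuth (row-insertion) correspondence. $R_i(w)$ denotes the $i$th row of $P(w)$ (empty if $P(w)$ has fewer than $i$ rows) and $\#R_i(w)$ its length. For a positive integer $a$, $c_a(w)$ is the number of columns of $P(w)$ of length exactly one whose sole entry is $a$. -}

module Defs where

open import Data.Nat using (ℕ; zero; suc; _<ᵇ_; _≟_)
open import Data.Bool using (Bool; true; false)
open import Data.Product using (_×_; _,_)
open import Data.Maybe using (Maybe; just; nothing)
open import Data.List using (List; []; _∷_; [_]; length; drop; foldl; filter)

-- A word is a list of positive integers (letters), read left to right;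
-- juxtaposition of words is list concatenation _++_.
Word : Set
Word = List ℕ

-- A (semistandard) tableau is represented by the list of its rows,
-- top (first) row first, each row listed left to right.
Tableau : Set
Tableau = List (List ℕ)

rowInsert : ℕ → List ℕ → List ℕ × Maybe ℕ
rowInsert x [] = [ x ] , nothing
rowInsert x (y ∷ ys) with x <ᵇ y
... | true  = (x ∷ ys) , just y
... | false with rowInsert x ys
...   | ys' , b = (y ∷ ys') , b

insert : ℕ → Tableau → Tableau
insert x [] = [ x ] ∷ []
insert x (r ∷ rs) with rowInsert x r
... | r' , nothing = r' ∷ rs
... | r' , just y  = r' ∷ insert y rs

P : Word → Tableau
P w = foldl (λ T x → insert x T) [] w

-- i-th row of a tableau (1-indexed); empty if there are fewer rows.
row : ℕ → Tableau → List ℕ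
row _ [] = []
row zero _ = []
row (suc zero) (r ∷ rs) = r
row (suc (suc i)) (r ∷ rs) = row (suc i) rs

R : ℕ → Word → List ℕ
R i w = row i (P w)

#R : ℕ → Word → ℕ
#R i w = length (R i w)

-- c_a(w): number of columns of P(w) of length exactly one whose entry is a.
-- The columns of length one are exactly the columns j with #R_2(w) ≤ j < #R_1(w)
-- (0-indexed), i.e. the entries of drop (#R_2 w) (R_1 w).
c : ℕ → Word → ℕ
c a w = length (filter (λ y → y ≟ a) (drop (#R 2 w) (R 1 w)))

{-# OPTIONS --safe #-}
module Submission where

-- Over {1,2}, P(w) has first row 1^(p+e) 2^b and second row 2^p, where p = #R₂(w),
-- e = c₁(w) and b = c₂(w). Inserting a 2 appends it to the first row; inserting a 1
-- bumps the leftmost 2 of the first row down to the second row if b > 0, and is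
-- appended otherwise. So (p, e, b) records the bracket matching of w in which 2 opens
-- and 1 closes: p matched pairs, e unmatched 1s, b unmatched 2s. In wu exactly
-- min(c₁(u), c₂(w)) further pairs form, between unmatched 2s of w and unmatched 1s of u.

open import Defs
open import Data.Bool using (true; false)
open import Data.Nat using (ℕ; zero; suc; _+_; _∸_; _⊓_; _≤_; _<_; _<ᵇ_; _≟_; z≤n; s≤s)
open import Data.Nat.Properties
  using (+-suc; +-identityʳ; +-∸-assoc; n∸n≡0; m≤n⇒m⊓n≡m; m≥n⇒m⊓n≡n; m≤n⇒m≤1+n; <⇒≤; ≤-<-connex)
open import Data.List using (List; []; _∷_; [_]; _++_; _∷ʳ_; length; drop; foldl; filter; replicate)
open import Data.List.Properties using (++-assoc; ++-identityʳ; foldl-++; length-replicate)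
open import Data.List.Relation.Unary.All using (All; []; _∷_)
open import Data.List.Relation.Unary.All.Properties using (++⁺)
open import Data.Maybe using (nothing; just)
open import Data.Product using (_,_)
open import Data.Sum using (_⊎_; inj₁; inj₂)
open import Relation.Binary.PropositionalEquality using (_≡_; refl; sym; trans; cong; cong₂; module ≡-Reasoning)

Letter₁₂ : ℕ → Set
Letter₁₂ x = x ≡ 1 ⊎ x ≡ 2

<ᵇ-false : ∀ {x y} → y ≤ x → (x <ᵇ y) ≡ false
<ᵇ-false z≤n       = refl
<ᵇ-false (s≤s y≤x) = <ᵇ-false y≤x

<ᵇ-true : ∀ {x y} → x < y → (x <ᵇ y) ≡ true
<ᵇ-true {zero}  (s≤s _)   = refl
<ᵇ-true {suc x} (s≤s x<y) = <ᵇ-true x<y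

rowInsert-append : ∀ {x xs} → All (_≤ x) xs → rowInsert x xs ≡ (xs ∷ʳ x , nothing)
rowInsert-append [] = refl
rowInsert-append (y≤x ∷ ys≤x) rewrite <ᵇ-false y≤x | rowInsert-append ys≤x = refl

rowInsert-bump : ∀ {x xs} y ys → All (_≤ x) xs → x < y →
                 rowInsert x (xs ++ y ∷ ys) ≡ (xs ++ x ∷ ys , just y)
rowInsert-bump y ys [] x<y rewrite <ᵇ-true x<y = refl
rowInsert-bump y ys (z≤x ∷ zs≤x) x<y rewrite <ᵇ-false z≤x | rowInsert-bump y ys zs≤x x<y = refl

insert-unbumped : ∀ x r {r′ rs} → rowInsert x r ≡ (r′ , nothing) → insert x (r ∷ rs) ≡ r′ ∷ rs
insert-unbumped x r eq rewrite eq = refl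

insert-bumped : ∀ x r {y r′ rs} → rowInsert x r ≡ (r′ , just y) → insert x (r ∷ rs) ≡ r′ ∷ insert y rs
insert-bumped x r eq rewrite eq = refl

replicate⁺ : ∀ {A : Set} {P : A → Set} {a} n → P a → All P (replicate n a)
replicate⁺ zero    pa = []
replicate⁺ (suc n) pa = pa ∷ replicate⁺ n pa

replicate-∷ʳ : ∀ {A : Set} n (a : A) → replicate n a ∷ʳ a ≡ replicate (suc n) a
replicate-∷ʳ zero    a = refl
replicate-∷ʳ (suc n) a = cong (a ∷_) (replicate-∷ʳ n a)

replicate-++-∷ : ∀ {A : Set} n (a : A) xs → replicate n a ++ a ∷ xs ≡ a ∷ replicate n a ++ xs
replicate-++-∷ zero    a xs = refl
replicate-++-∷ (suc n) a xs = cong (a ∷_) (replicate-++-∷ n a xs)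

record Shape : Set where
  constructor shape
  field
    pairs ones twos : ℕ
open Shape

firstRow : Shape → List ℕ
firstRow s = replicate (pairs s + ones s) 1 ++ replicate (twos s) 2

lowerRows : ℕ → Tableau
lowerRows zero    = []
lowerRows (suc p) = [ replicate (suc p) 2 ]

tableau : Shape → Tableau
tableau s = firstRow s ∷ lowerRows (pairs s)

-- Letters other than 1 act as 2; only words over {1,2} are ever pushed.
push : ℕ → Shape → Shape
push 1 (shape p e zero)    = shape p (suc e) zero
push 1 (shape p e (suc b)) = shape (suc p) e b
push _ (shape p e b)       = shape p e (suc b)

firstRow-≤2 : ∀ s → All (_≤ 2) (firstRow s)
firstRow-≤2 s = ++⁺ (replicate⁺ (pairs s + ones s) (s≤s z≤n)) (replicate⁺ (twos s) (s≤s (s≤s z≤n)))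

rowInsert-2-firstRow : ∀ s → rowInsert 2 (firstRow s) ≡ (firstRow (push 2 s) , nothing)
rowInsert-2-firstRow s@(shape p e b) =
  trans (rowInsert-append (firstRow-≤2 s)) (cong (_, nothing) (begin
    (replicate (p + e) 1 ++ replicate b 2) ∷ʳ 2   ≡⟨ ++-assoc (replicate (p + e) 1) (replicate b 2) [ 2 ] ⟩
    replicate (p + e) 1 ++ replicate b 2 ∷ʳ 2     ≡⟨ cong (replicate (p + e) 1 ++_) (replicate-∷ʳ b 2) ⟩
    replicate (p + e) 1 ++ replicate (suc b) 2    ∎))
  where open ≡-Reasoning

rowInsert-1-firstRow-append : ∀ p e →
  rowInsert 1 (firstRow (shape p e 0)) ≡ (firstRow (shape p (suc e) 0) , nothing)
rowInsert-1-firstRow-append p e =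
  trans (rowInsert-append (++⁺ (replicate⁺ (p + e) (s≤s z≤n)) [])) (cong (_, nothing) (begin
    (replicate (p + e) 1 ++ []) ∷ʳ 1   ≡⟨ cong (_∷ʳ 1) (++-identityʳ (replicate (p + e) 1)) ⟩
    replicate (p + e) 1 ∷ʳ 1           ≡⟨ replicate-∷ʳ (p + e) 1 ⟩
    replicate (suc (p + e)) 1          ≡⟨ cong (λ n → replicate n 1) (sym (+-suc p e)) ⟩
    replicate (p + suc e) 1            ≡⟨ ++-identityʳ (replicate (p + suc e) 1) ⟨
    replicate (p + suc e) 1 ++ []      ∎))
  where open ≡-Reasoning

rowInsert-1-firstRow-bump : ∀ p e b →
  rowInsert 1 (firstRow (shape p e (suc b))) ≡ (firstRow (shape (suc p) e b) , just 2)
rowInsert-1-firstRow-bump p e b =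
  trans (rowInsert-bump 2 (replicate b 2) (replicate⁺ (p + e) (s≤s z≤n)) (s≤s (s≤s z≤n)))
        (cong (_, just 2) (replicate-++-∷ (p + e) 1 (replicate b 2)))

insert-2-lowerRows : ∀ p → insert 2 (lowerRows p) ≡ lowerRows (suc p)
insert-2-lowerRows zero    = refl
insert-2-lowerRows (suc p) =
  trans (insert-unbumped 2 (replicate (suc p) 2) (rowInsert-append (replicate⁺ (suc p) (s≤s (s≤s z≤n)))))
        (cong [_] (replicate-∷ʳ (suc p) 2))

insert-tableau : ∀ {x} → Letter₁₂ x → ∀ s → insert x (tableau s) ≡ tableau (push x s)
insert-tableau (inj₂ refl) s                   = insert-unbumped 2 (firstRow s) (rowInsert-2-firstRow s)
insert-tableau (inj₁ refl) (shape p e zero)    =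
  insert-unbumped 1 (firstRow (shape p e 0)) (rowInsert-1-firstRow-append p e)
insert-tableau (inj₁ refl) (shape p e (suc b)) =
  trans (insert-bumped 1 (firstRow (shape p e (suc b))) (rowInsert-1-firstRow-bump p e b))
        (cong (firstRow (shape (suc p) e b) ∷_) (insert-2-lowerRows p))

ε : Shape
ε = shape 0 0 0

shapeAfter : Shape → Word → Shape
shapeAfter = foldl (λ s x → push x s)

shapeOf : Word → Shape
shapeOf = shapeAfter ε

foldl-insert-tableau : ∀ {w} → All Letter₁₂ w → ∀ s →
                       foldl (λ T x → insert x T) (tableau s) w ≡ tableau (shapeAfter s w)
foldl-insert-tableau []         s = refl
foldl-insert-tableau (px ∷ pw) s rewrite insert-tableau px s = foldl-insert-tableau pw (push _ s)

-- P [] is the empty tableau, whereas tableau ε has a single empty row.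
row-[]≡row-[[]] : ∀ i → row i [] ≡ row i [ [] ]
row-[]≡row-[[]] zero          = refl
row-[]≡row-[[]] (suc zero)    = refl
row-[]≡row-[[]] (suc (suc i)) = refl

R≡row-tableau : ∀ i {w} → All Letter₁₂ w → R i w ≡ row i (tableau (shapeOf w))
R≡row-tableau i {[]}    []  = row-[]≡row-[[]] i
R≡row-tableau i {x ∷ w} pxw = cong (row i) (foldl-insert-tableau pxw ε)

length-row₂-tableau : ∀ s → length (row 2 (tableau s)) ≡ pairs s
length-row₂-tableau (shape zero    e b) = refl
length-row₂-tableau (shape (suc p) e b) = length-replicate (suc p)

#R₂≡pairs : ∀ {w} → All Letter₁₂ w → #R 2 w ≡ pairs (shapeOf w)
#R₂≡pairs {w} pw = trans (cong length (R≡row-tableau 2 pw)) (length-row₂-tableau (shapeOf w))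

count : ℕ → List ℕ → ℕ
count a xs = length (filter (_≟ a) xs)

count-1-singles : ∀ e b → count 1 (replicate e 1 ++ replicate b 2) ≡ e
count-1-singles (suc e) b       = cong suc (count-1-singles e b)
count-1-singles zero    zero    = refl
count-1-singles zero    (suc b) = count-1-singles zero b

count-2-singles : ∀ e b → count 2 (replicate e 1 ++ replicate b 2) ≡ b
count-2-singles (suc e) b       = count-2-singles e b
count-2-singles zero    zero    = refl
count-2-singles zero    (suc b) = cong suc (count-2-singles zero b)

drop-pairs-firstRow : ∀ s → drop (pairs s) (firstRow s) ≡ replicate (ones s) 1 ++ replicate (twos s) 2
drop-pairs-firstRow (shape zero    e b) = refl
drop-pairs-firstRow (shape (suc p) e b) = drop-pairs-firstRow (shape p e b)

c≡count-singles : ∀ a {w} → All Letter₁₂ w →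
                  c a w ≡ count a (replicate (ones (shapeOf w)) 1 ++ replicate (twos (shapeOf w)) 2)
c≡count-singles a {w} pw = begin
  count a (drop (#R 2 w) (R 1 w))
    ≡⟨ cong₂ (λ n r → count a (drop n r)) (#R₂≡pairs pw) (R≡row-tableau 1 pw) ⟩
  count a (drop (pairs (shapeOf w)) (firstRow (shapeOf w)))
    ≡⟨ cong (count a) (drop-pairs-firstRow (shapeOf w)) ⟩
  count a (replicate (ones (shapeOf w)) 1 ++ replicate (twos (shapeOf w)) 2) ∎
  where open ≡-Reasoning

c₁≡ones : ∀ {w} → All Letter₁₂ w → c 1 w ≡ ones (shapeOf w)
c₁≡ones {w} pw = trans (c≡count-singles 1 pw) (count-1-singles (ones (shapeOf w)) (twos (shapeOf w)))

c₂≡twos : ∀ {w} → All Letter₁₂ w → c 2 w ≡ twos (shapeOf w)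
c₂≡twos {w} pw = trans (c≡count-singles 2 pw) (count-2-singles (ones (shapeOf w)) (twos (shapeOf w)))

_∙_ : Shape → Shape → Shape
shape p e b ∙ shape p′ e′ b′ = shape (p + p′ + m) (e + (e′ ∸ m)) ((b ∸ m) + b′)
  where m = e′ ⊓ b

∙-identityʳ : ∀ s → s ∙ ε ≡ s
∙-identityʳ (shape p e b) rewrite +-identityʳ p | +-identityʳ e | +-identityʳ b | +-identityʳ p = refl

push-1-∙ : ∀ s t → push 1 (s ∙ t) ≡ s ∙ push 1 t
push-1-∙ (shape p e b) (shape p′ e′ (suc b′))
  rewrite +-suc (b ∸ (e′ ⊓ b)) b′ | +-suc p p′ = refl
-- The new 1 is matched iff s has more unmatched 2s than t has unmatched 1s.
push-1-∙ (shape p e b) (shape p′ e′ zero) with ≤-<-connex b e′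
... | inj₁ b≤e′
  rewrite m≥n⇒m⊓n≡n b≤e′ | m≥n⇒m⊓n≡n (m≤n⇒m≤1+n b≤e′) | n∸n≡0 b
        | +-∸-assoc 1 b≤e′ | +-suc e (e′ ∸ b) = refl
... | inj₂ e′<b
  rewrite m≤n⇒m⊓n≡m (<⇒≤ e′<b) | m≤n⇒m⊓n≡m e′<b | n∸n≡0 e′
        | +-∸-assoc 1 e′<b | +-suc (p + p′) e′ = refl

push-∙ : ∀ {x} → Letter₁₂ x → ∀ s t → push x (s ∙ t) ≡ s ∙ push x t
push-∙ (inj₁ refl) s t = push-1-∙ s t
push-∙ (inj₂ refl) (shape p e b) (shape p′ e′ b′) = cong (shape _ _) (sym (+-suc (b ∸ (e′ ⊓ b)) b′))

shapeAfter-∙ : ∀ {u} → All Letter₁₂ u → ∀ s t → shapeAfter (s ∙ t) u ≡ s ∙ shapeAfter t u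
shapeAfter-∙ []         s t = refl
shapeAfter-∙ (px ∷ pu) s t rewrite push-∙ px s t = shapeAfter-∙ pu s (push _ t)

shapeOf-++ : ∀ w {u} → All Letter₁₂ u → shapeOf (w ++ u) ≡ shapeOf w ∙ shapeOf u
shapeOf-++ w {u} pu = begin
  shapeOf (w ++ u)              ≡⟨ foldl-++ (λ s x → push x s) ε w u ⟩
  shapeAfter (shapeOf w) u      ≡⟨ cong (λ s → shapeAfter s u) (∙-identityʳ (shapeOf w)) ⟨
  shapeAfter (shapeOf w ∙ ε) u  ≡⟨ shapeAfter-∙ pu (shapeOf w) ε ⟩
  shapeOf w ∙ shapeOf u         ∎
  where open ≡-Reasoning

lemma2p7 : (u w : Word) →
    All (λ x → x ≡ 1 ⊎ x ≡ 2) u →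
    All (λ x → x ≡ 1 ⊎ x ≡ 2) w →
    #R 2 (w ++ u) ≡ #R 2 w + #R 2 u + (c 1 u ⊓ c 2 w)
lemma2p7 u w pu pw = begin
  #R 2 (w ++ u)               ≡⟨ #R₂≡pairs (++⁺ pw pu) ⟩
  pairs (shapeOf (w ++ u))    ≡⟨ cong pairs (shapeOf-++ w pu) ⟩
  pairs (shapeOf w) + pairs (shapeOf u) + (ones (shapeOf u) ⊓ twos (shapeOf w))
    ≡⟨ cong₂ _+_ (cong₂ _+_ (#R₂≡pairs pw) (#R₂≡pairs pu)) (cong₂ _⊓_ (c₁≡ones pu) (c₂≡twos pw)) ⟨
  #R 2 w + #R 2 u + (c 1 u ⊓ c 2 w) ∎
  where open ≡-Reasoning
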